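{- For every positive integer $n$ and every odd positive integer $k$, $z_k(2n)=z_k(2n-1)$.
   Context: A partition of $n$ is a weakly decreasing finite sequence of positive integers (its parts) summing to $n$. $\mathcal O(n)$ is the set of partitions of $n$ all of whose parts are odd. For a partition $\lambda=(\lambda_1,\ldots,\lambda_\ell)$ with $\ell\ge k$, $\mathrm{pre}_k(\lambda)$ is the partition whose parts are the products $\lambda_{i_1}\cdots\lambda_{i_k}$ over all $1\le i_1<\cdots<i_k\le\ell$ (with multiplicity); it is undefined if $\ell<k$. $z_k(n)$ is the number of distinct positive integers $x$ that occur as a part of $\mathrm{pre}_k(\lambda)$ for some $\lambda\in\mathcal O(n)$ with at least $k$ parts; equivalently, the number of integers $x=\lambda_{i_1}\cdots\lambda_{i_k}$ with $i_1<\cdots<i_k$ for some $\lambda\in\mathcal O(n)$. -}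

module Defs where

open import Data.Nat using (ℕ; suc; _≥_; _≤_)
open import Data.Nat.Properties using ()
open import Data.Nat.Divisibility using ()
open import Data.Nat.Base using (_%_; NonZero)
open import Data.List using (List; length)
open import Data.Nat.ListAction using (sum; product)
open import Data.List.Relation.Unary.All using (All)
open import Data.List.Relation.Unary.Linked using (Linked)
open import Data.List.Relation.Unary.Unique.Propositional using (Unique)
open import Data.List.Membership.Propositional using (_∈_)
open import Data.List.Relation.Binary.Sublist.Propositional using (_⊆_)
open import Data.Product using (Σ; _×_; ∃; ∃-syntax)
open import Function.Bundles using (_⇔_)
open import Relation.Binary.PropositionalEquality using (_≡_)

Odd : ℕ → Set
Odd m = m % 2 ≡ 1

-- λ is a partition of n into odd parts: weakly decreasing list of
-- positive odd integers summing to n (odd implies positive).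
IsOddPartition : ℕ → List ℕ → Set
IsOddPartition n λs = Linked _≥_ λs × All Odd λs × sum λs ≡ n

-- x is a part of pre_k(λ) for some λ ∈ O(n): there is λ ∈ O(n) and a
-- subsequence (choice of indices i₁ < ⋯ < iₖ) μ of λ of length k
-- whose product is x.
InPre : ℕ → ℕ → ℕ → Set
InPre k n x =
  ∃[ λs ] ∃[ μ ] (IsOddPartition n λs × μ ⊆ λs × length μ ≡ k × product μ ≡ x)

HasCard : (ℕ → Set) → ℕ → Set
HasCard P m = ∃[ xs ] (Unique xs × length xs ≡ m × (∀ x → (x ∈ xs) ⇔ P x))

IsZ : ℕ → ℕ → ℕ → Set
IsZ k n m = HasCard (InPre k n) m

module Submission where

-- A part of pre_k(λ), λ ∈ O(N), is the product of a weakly decreasing list of k odd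
-- numbers whose sum is at most N; conversely such a list, padded with 1s, is an odd
-- partition of N. For odd k the sum of k odd numbers is odd, so the bounds 2n+2 and
-- 2n+1 admit the same lists, and both z_k(2n+2) and z_k(2n+1) count the products of
-- one finite, decidable family of bounded lists.

open import Defs
open import Data.Nat using (ℕ; zero; suc; _*_; _+_; _∸_; _≤_; _<_; _≥_; _≥?_; _≤?_; _%_; z≤n; s≤s)
open import Data.Nat.Properties
open import Data.Nat.DivMod using (%-distribˡ-+; m*n%n≡0)
open import Data.Product using (∃-syntax; _×_; _,_)
open import Data.List using (List; []; _∷_; _++_; replicate; length; map; filter; deduplicate; upTo; cartesianProductWith)
open import Data.Nat.ListAction using (sum; product)
open import Data.Nat.ListAction.Properties using (sum-++)
open import Data.List.Relation.Unary.All as All using (All; []; _∷_; all?)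
open import Data.List.Relation.Unary.All.Properties using (++⁺; replicate⁺)
open import Data.List.Relation.Unary.Linked using (Linked; []; [-]; _∷_; linked?)
open import Data.List.Relation.Unary.Linked.Properties using (Linked⇒AllPairs; AllPairs⇒Linked)
open import Data.List.Relation.Unary.AllPairs using (AllPairs; []; _∷_)
open import Data.List.Relation.Binary.Sublist.Propositional using (_⊆_; []; _∷_; _∷ʳ_; ⊆-refl)
open import Data.List.Relation.Binary.Sublist.Propositional.Properties using (All-resp-⊆; ++⁺ʳ)
open import Data.List.Membership.Propositional using (_∈_)
open import Data.List.Membership.Propositional.Properties
open import Data.List.Relation.Unary.Any using (here; there)
open import Data.List.Relation.Unary.Unique.DecPropositional.Properties using (deduplicate-!)
open import Function.Base using (flip)
open import Function.Bundles using (_⇔_; mk⇔)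
import Function.Properties.Equivalence as ⇔
open import Relation.Binary.Definitions using (Reflexive; Transitive)
open import Relation.Binary.PropositionalEquality using (_≡_; refl; sym; trans; cong; subst; _≢_; module ≡-Reasoning)
open import Relation.Nullary.Decidable using (_×-dec_)
open import Relation.Unary using (Decidable)

HasCard-resp-⇔ : ∀ {P Q : ℕ → Set} {m} → (∀ x → P x ⇔ Q x) → HasCard P m → HasCard Q m
HasCard-resp-⇔ P⇔Q (xs , unique , len , ∈⇔P) = xs , unique , len , λ x → ⇔.trans (∈⇔P x) (P⇔Q x)

hasCard-image : ∀ {A : Set} {Q : A → Set} → Decidable Q → (f : A → ℕ) (as : List A) →
  ∃[ m ] HasCard (λ x → ∃[ a ] (a ∈ as × Q a × f a ≡ x)) m
hasCard-image {Q = Q} Q? f as = _ , xs , deduplicate-! _≟_ _ , refl , λ x → mk⇔ to from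
  where
  xs : List ℕ
  xs = deduplicate _≟_ (map f (filter Q? as))
  to : ∀ {x} → x ∈ xs → ∃[ a ] (a ∈ as × Q a × f a ≡ x)
  to x∈xs with a , a∈as , x≡fa , Qa ← ∈-map∘filter⁻ f {P = Q} Q? (∈-deduplicate⁻ _≟_ _ x∈xs) =
    a , a∈as , Qa , sym x≡fa
  from : ∀ {x} → ∃[ a ] (a ∈ as × Q a × f a ≡ x) → x ∈ xs
  from (a , a∈as , Qa , refl) = ∈-deduplicate⁺ _≟_ (∈-map∘filter⁺ f {P = Q} Q? (a , a∈as , refl , Qa))

sum-mono-⊆ : ∀ {μ λs} → μ ⊆ λs → sum μ ≤ sum λs
sum-mono-⊆ []           = ≤-refl
sum-mono-⊆ (y ∷ʳ μ⊆λ)   = ≤-trans (sum-mono-⊆ μ⊆λ) (m≤n+m _ y)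
sum-mono-⊆ (refl ∷ μ⊆λ) = +-monoʳ-≤ _ (sum-mono-⊆ μ⊆λ)

AllPairs-resp-⊆ : ∀ {A : Set} {R : A → A → Set} {xs ys} → ys ⊆ xs → AllPairs R xs → AllPairs R ys
AllPairs-resp-⊆ []             []         = []
AllPairs-resp-⊆ (_ ∷ʳ ys⊆xs)   (_ ∷ Rxs)  = AllPairs-resp-⊆ ys⊆xs Rxs
AllPairs-resp-⊆ (refl ∷ ys⊆xs) (Rx ∷ Rxs) = All-resp-⊆ ys⊆xs Rx ∷ AllPairs-resp-⊆ ys⊆xs Rxs

Linked-resp-⊆ : ∀ {A : Set} {R : A → A → Set} {xs ys} → Transitive R → ys ⊆ xs → Linked R xs → Linked R ys
Linked-resp-⊆ R-trans ys⊆xs Rxs =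
  AllPairs⇒Linked (AllPairs-resp-⊆ ys⊆xs (Linked⇒AllPairs R-trans Rxs))

∈⇒≤sum : ∀ {n ns} → n ∈ ns → n ≤ sum ns
∈⇒≤sum {ns = n ∷ ns} (here refl)  = m≤m+n n (sum ns)
∈⇒≤sum {ns = m ∷ ns} (there n∈ns) = ≤-trans (∈⇒≤sum n∈ns) (m≤n+m (sum ns) m)

sum-replicate : ∀ r a → sum (replicate r a) ≡ r * a
sum-replicate zero    a = refl
sum-replicate (suc r) a = cong (a +_) (sum-replicate r a)

Linked-replicate : ∀ {A : Set} {R : A → A → Set} → Reflexive R → ∀ r {a} → Linked R (replicate r a)
Linked-replicate R-refl zero          = []
Linked-replicate R-refl (suc zero)    = [-]
Linked-replicate R-refl (suc (suc r)) = R-refl ∷ Linked-replicate R-refl (suc r)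

Linked-++-replicate : ∀ {μ a} r → Linked _≥_ μ → All (_≥ a) μ → Linked _≥_ (μ ++ replicate r a)
Linked-++-replicate r       []  _          = Linked-replicate ≤-refl r
Linked-++-replicate zero    [-] _          = [-]
Linked-++-replicate (suc r) [-] (x≥a ∷ []) = x≥a ∷ Linked-replicate ≤-refl (suc r)
Linked-++-replicate r (x≥y ∷ μ↓) (_ ∷ μ≥a)  = x≥y ∷ Linked-++-replicate r μ↓ μ≥a

sum%2≡length%2 : ∀ {μ} → All Odd μ → sum μ % 2 ≡ length μ % 2
sum%2≡length%2 [] = refl
sum%2≡length%2 {a ∷ μ} (a-odd ∷ μ-odd) = begin
  (a + sum μ) % 2          ≡⟨ %-distribˡ-+ a (sum μ) 2 ⟩
  (a % 2 + sum μ % 2) % 2  ≡⟨ cong (λ r → (r + sum μ % 2) % 2) a-odd ⟩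
  (1 + sum μ % 2) % 2      ≡⟨ cong (λ r → (1 + r) % 2) (sum%2≡length%2 μ-odd) ⟩
  (1 + length μ % 2) % 2   ≡⟨ %-distribˡ-+ 1 (length μ) 2 ⟨
  (1 + length μ) % 2       ∎
  where open ≡-Reasoning

odd⇒≥1 : ∀ {a} → Odd a → a ≥ 1
odd⇒≥1 {suc _} _ = s≤s z≤n

2[1+n]≡1+[2n+1] : ∀ n → 2 * suc n ≡ suc (2 * n + 1)
2[1+n]≡1+[2n+1] n = trans (*-suc 2 n) (trans (+-comm 2 (2 * n)) (+-suc (2 * n) 1))

odd≤2[1+n]⇒≤2n+1 : ∀ {s} n → Odd s → s ≤ 2 * suc n → s ≤ 2 * n + 1
odd≤2[1+n]⇒≤2n+1 {s} n s-odd s≤2[1+n] =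
  ≤-pred (subst (s <_) (2[1+n]≡1+[2n+1] n) (≤∧≢⇒< s≤2[1+n] s≢2[1+n]))
  where
  s≢2[1+n] : s ≢ 2 * suc n
  s≢2[1+n] refl = 1+n≢0 (trans (sym s-odd) (trans (cong (_% 2) (*-comm 2 (suc n))) (m*n%n≡0 (suc n) 2)))

listsBelow : ℕ → ℕ → List (List ℕ)
listsBelow zero    b = [] ∷ []
listsBelow (suc k) b = cartesianProductWith _∷_ (upTo b) (listsBelow k b)

∈-listsBelow⁻ : ∀ k b {μ} → μ ∈ listsBelow k b → length μ ≡ k
∈-listsBelow⁻ zero    b (here refl) = refl
∈-listsBelow⁻ (suc k) b μ∈
  with _ , _ , _ , μ′∈ , refl ← ∈-cartesianProductWith⁻ _∷_ (upTo b) (listsBelow k b) μ∈ =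
  cong suc (∈-listsBelow⁻ k b μ′∈)

∈-listsBelow⁺ : ∀ {b μ} → All (_< b) μ → μ ∈ listsBelow (length μ) b
∈-listsBelow⁺ []         = here refl
∈-listsBelow⁺ (a<b ∷ μ<b) = ∈-cartesianProductWith⁺ _∷_ (∈-upTo⁺ a<b) (∈-listsBelow⁺ μ<b)

IsOddPartitionWithin : ℕ → List ℕ → Set
IsOddPartitionWithin N μ = Linked _≥_ μ × All Odd μ × sum μ ≤ N

isOddPartitionWithin? : ∀ N → Decidable (IsOddPartitionWithin N)
isOddPartitionWithin? N μ = linked? _≥?_ μ ×-dec all? (λ a → a % 2 ≟ 1) μ ×-dec sum μ ≤? N

PreWithin : ℕ → ℕ → ℕ → Set
PreWithin k N x = ∃[ μ ] (IsOddPartitionWithin N μ × length μ ≡ k × product μ ≡ x)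

InPre⇔PreWithin : ∀ k N x → InPre k N x ⇔ PreWithin k N x
InPre⇔PreWithin k N x = mk⇔ to from
  where
  to : InPre k N x → PreWithin k N x
  to (λs , μ , (λ↓ , λ-odd , Σλ≡N) , μ⊆λ , len , prod) =
    μ , (Linked-resp-⊆ (flip ≤-trans) μ⊆λ λ↓ , All-resp-⊆ μ⊆λ λ-odd , Σμ≤N) , len , prod
    where
    Σμ≤N : sum μ ≤ N
    Σμ≤N = subst (sum μ ≤_) Σλ≡N (sum-mono-⊆ μ⊆λ)
  from : PreWithin k N x → InPre k N x
  from (μ , (μ↓ , μ-odd , Σμ≤N) , len , prod) =
    μ ++ ones , μ , (padded↓ , ++⁺ μ-odd (replicate⁺ _ refl) , Σpadded≡N) , ++⁺ʳ ones ⊆-refl , len , prod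
    where
    ones : List ℕ
    ones = replicate (N ∸ sum μ) 1
    padded↓ : Linked _≥_ (μ ++ ones)
    padded↓ = Linked-++-replicate _ μ↓ (All.map odd⇒≥1 μ-odd)
    Σpadded≡N : sum (μ ++ ones) ≡ N
    Σpadded≡N = begin
      sum (μ ++ ones)      ≡⟨ sum-++ μ ones ⟩
      sum μ + sum ones     ≡⟨ cong (sum μ +_) (trans (sum-replicate (N ∸ sum μ) 1) (*-identityʳ _)) ⟩
      sum μ + (N ∸ sum μ)  ≡⟨ m+[n∸m]≡n Σμ≤N ⟩
      N                    ∎
      where open ≡-Reasoning

PreEnumerated : ℕ → ℕ → ℕ → Set
PreEnumerated k N x = ∃[ μ ] (μ ∈ listsBelow k (suc N) × IsOddPartitionWithin N μ × product μ ≡ x)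

PreWithin⇔PreEnumerated : ∀ k N x → PreWithin k N x ⇔ PreEnumerated k N x
PreWithin⇔PreEnumerated k N x = mk⇔ to from
  where
  to : PreWithin k N x → PreEnumerated k N x
  to (μ , μ-within@(_ , _ , Σμ≤N) , refl , prod) =
    μ , ∈-listsBelow⁺ (All.tabulate (λ a∈μ → s≤s (≤-trans (∈⇒≤sum a∈μ) Σμ≤N))) , μ-within , prod
  from : PreEnumerated k N x → PreWithin k N x
  from (μ , μ∈ , μ-within , prod) = μ , μ-within , ∈-listsBelow⁻ k (suc N) μ∈ , prod

PreWithin-2[1+n]⇔2n+1 : ∀ n k x → Odd k → PreWithin k (2 * suc n) x ⇔ PreWithin k (2 * n + 1) x
PreWithin-2[1+n]⇔2n+1 n k x k-odd = mk⇔ to from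
  where
  to : PreWithin k (2 * suc n) x → PreWithin k (2 * n + 1) x
  to (μ , (μ↓ , μ-odd , Σμ≤) , refl , prod) =
    μ , (μ↓ , μ-odd , odd≤2[1+n]⇒≤2n+1 n (trans (sum%2≡length%2 μ-odd) k-odd) Σμ≤) , refl , prod
  from : PreWithin k (2 * n + 1) x → PreWithin k (2 * suc n) x
  from (μ , (μ↓ , μ-odd , Σμ≤) , len , prod) =
    μ , (μ↓ , μ-odd , ≤-trans Σμ≤ (≤-trans (n≤1+n _) (≤-reflexive (sym (2[1+n]≡1+[2n+1] n))))) , len , prod

theorem3p8 : (n k : ℕ) → Odd k →
    ∃[ m ] (IsZ k (2 * suc n) m × IsZ k (2 * n + 1) m)
theorem3p8 n k k-odd =
  let m , card = hasCard-image (isOddPartitionWithin? N) product (listsBelow k (suc N))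
  in m , HasCard-resp-⇔ (λ x → ⇔.sym (even x)) card , HasCard-resp-⇔ (λ x → ⇔.sym (odd x)) card
  where
  N = 2 * suc n
  even : ∀ x → InPre k N x ⇔ PreEnumerated k N x
  even x = ⇔.trans (InPre⇔PreWithin k N x) (PreWithin⇔PreEnumerated k N x)
  odd : ∀ x → InPre k (2 * n + 1) x ⇔ PreEnumerated k N x
  odd x = ⇔.trans (InPre⇔PreWithin k (2 * n + 1) x)
            (⇔.trans (⇔.sym (PreWithin-2[1+n]⇔2n+1 n k x k-odd)) (PreWithin⇔PreEnumerated k N x))
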